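{- $a_{\{0101,0112,0120\}}(1)=1$, and for all $n\ge2$, \[a_{\{0101,0112,0120\}}(n)=\frac1{24}\left(n^4-6n^3+47n^2-114n+120\right).\]
   Context: An ascent in an integer sequence $s_1\cdots s_m$ is an index $j$ with $s_j<s_{j+1}$; $\mathrm{asc}(s)$ is the number of ascents. An ascent sequence is a sequence $x_1\cdots x_n$ of nonnegative integers with $x_1=0$ and $x_i\le 1+\mathrm{asc}(x_1\cdots x_{i-1})$ for $i\ge2$. For a sequence $w$, $\mathrm{red}(w)$ replaces the $i$-th smallest distinct letter of $w$ by $i-1$. A pattern (e.g. $0101$, meaning the sequence $(0,1,0,1)$) is a sequence equal to its reduction. A sequence $x$ contains pattern $p=p_1\cdots p_k$ if there are indices $i_1<\cdots<i_k$ with $\mathrm{red}(x_{i_1}\cdots x_{i_k})=p$; otherwise it avoids $p$. For a set of patterns $P$, $\mathcal A_n(P)$ is the set of ascent sequences of length $n$ avoiding every pattern in $P$, and $a_P(n)=|\mathcal A_n(P)|$. -}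

module Defs where

open import Data.Bool using (Bool; true; false; _∧_; T; if_then_else_)
open import Data.Nat using (ℕ; zero; suc; _+_; _<ᵇ_; _≤ᵇ_; _≡ᵇ_; _<?_; _≟_)
open import Data.List using (List; []; _∷_; _++_; [_]; length; map; filter; deduplicate)
open import Data.Bool.ListAction using (any)
open import Relation.Binary.PropositionalEquality using (_≡_)
import Data.List.Properties as LP
open import Data.Product using (Σ; _×_)
open import Relation.Nullary.Decidable using (⌊_⌋)
open import Relation.Nullary using (¬?)

asc : List ℕ → ℕ
asc [] = zero
asc (x ∷ []) = zero
asc (x ∷ y ∷ s) = (if x <ᵇ y then 1 else 0) + asc (y ∷ s)

checkFrom : List ℕ → List ℕ → Bool
checkFrom pre [] = true
checkFrom pre (x ∷ rest) = (x ≤ᵇ suc (asc pre)) ∧ checkFrom (pre ++ [ x ]) rest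

-- Ascent sequence: x_1 = 0 and x_i ≤ 1 + asc(x_1 ⋯ x_{i-1}) for i ≥ 2.
-- (The empty sequence is accepted; it is irrelevant since only n ≥ 1 is used.)
isAscentSeq : List ℕ → Bool
isAscentSeq [] = true
isAscentSeq (x ∷ xs) = (x ≡ᵇ 0) ∧ checkFrom [ x ] xs

-- red(w): replace the i-th smallest distinct letter of w by i-1, i.e. each letter a
-- becomes the number of distinct letters of w that are smaller than a.
red : List ℕ → List ℕ
red w = map (λ a → length (deduplicate _≟_ (filter (λ b → b <? a) w))) w

subseqsOfLength : ℕ → List ℕ → List (List ℕ)
subseqsOfLength zero xs = [] ∷ []
subseqsOfLength (suc k) [] = []
subseqsOfLength (suc k) (x ∷ xs) =
  map (x ∷_) (subseqsOfLength k xs) ++ subseqsOfLength (suc k) xs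

contains : List ℕ → List ℕ → Bool
contains p x = any (λ s → ⌊ LP.≡-dec _≟_ (red s) p ⌋) (subseqsOfLength (length p) x)

avoids : List ℕ → List ℕ → Bool
avoids p x with contains p x
... | true  = false
... | false = true

avoidsAll : List (List ℕ) → List ℕ → Bool
avoidsAll [] x = true
avoidsAll (p ∷ ps) x = avoids p x ∧ avoidsAll ps x

-- 𝒜_n(P): ascent sequences of length n avoiding every pattern in P (as a Σ-type;
-- the predicates are Bool-valued, hence proof-irrelevant, so this is a subset of List ℕ).
𝒜 : List (List ℕ) → ℕ → Set
𝒜 P n = Σ (List ℕ) (λ x → (length x ≡ n) × T (isAscentSeq x ∧ avoidsAll P x))

P₃ : List (List ℕ)
P₃ = (0 ∷ 1 ∷ 0 ∷ 1 ∷ []) ∷ (0 ∷ 1 ∷ 1 ∷ 2 ∷ []) ∷ (0 ∷ 1 ∷ 2 ∷ 0 ∷ []) ∷ []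

module Submission where

-- Appending a letter y to a word X creates an occurrence of a pattern of P₃ exactly when X has
-- a subsequence s such that s y is an occurrence; call y forbidden after X.  In a P₃-avoiding
-- ascent sequence X with k = asc X the letters are exactly 0, …, k and every ascending pair
-- u < v ≤ k occurs, so the letters forbidden after X y are those forbidden after X together
-- with a set that depends only on k and y.  Hence these sequences are exactly the words of a
-- deterministic automaton with ten states ("shapes") whose steps repeat the last letter, lower
-- it by one, or rise to the new maximum k + 1.  Counting its paths shape by shape gives linear
-- recurrences whose solutions are polynomials of degree at most 4 in the length; their sum is
-- the quartic of the theorem.

open import Level using (Level)
open import Data.Bool using (true; false; T; _∧_; if_then_else_)
open import Data.Bool.Properties using (T-∧; T-irrelevant; ∧-assoc; ∧-identityʳ)
open import Data.Empty using (⊥)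
open import Data.Fin using (Fin; zero)
open import Data.Fin.Properties using (0↔⊥; +↔⊎)
open import Data.Integer using (ℤ; +_; 0ℤ; 1ℤ; _+_; _-_; -_; _*_; _^_)
import Data.Integer.Properties as ℤ
open import Data.Integer.Properties using (pos-+; pos-*)
open import Data.Integer.Tactic.RingSolver using (solve-∀)
open import Data.List
  using (List; []; _∷_; _++_; _∷ʳ_; [_]; length; map; filter; deduplicate; foldr; initLast; _∷ʳ′_)
open import Data.List.Properties
  using ( length-map; length-++; length-filter; filter-notAll; filter-≐; map-∘; map-cong
        ; ++-identityʳ; ++-assoc; ∷-injectiveʳ; ∷ʳ-injective)
open import Data.List.Membership.Propositional using (_∈_; find; lose)
open import Data.List.Membership.Propositional.Properties
  using (∈-filter⁺; ∈-deduplicate⁺; ∈-++⁺ˡ; ∈-++⁺ʳ; ∈-++⁻; ∈-map⁺; ∈-map⁻)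
open import Data.List.Membership.Propositional.Properties.Core using (Any↔)
open import Data.List.Relation.Binary.Sublist.Propositional
  using (_⊆_; []; _∷_; minimum; ⊆-refl; from∈; lookup)
  renaming (_∷ʳ_ to skip)
open import Data.List.Relation.Binary.Sublist.Propositional.Properties using (++⁺; ++⁺ʳ)
open import Data.List.Relation.Unary.All using (All; []; _∷_)
import Data.List.Relation.Unary.All as All
open import Data.List.Relation.Unary.Any using (Any; here; there)
import Data.List.Relation.Unary.Any as Any
open import Data.List.Relation.Unary.Any.Properties using (any⁺; any⁻; ⊥↔Any[]; ∷↔)
import Data.Nat as ℕ
open import Data.Nat
  using (ℕ; zero; suc; pred; _≤_; _<_; z≤n; s≤s; z<s; s<s; _≟_; _<?_; _<ᵇ_; _≤ᵇ_; _≡ᵇ_)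
open import Data.Nat.ListAction using (sum)
open import Data.Nat.Properties
  using ( ≤-refl; ≤-reflexive; ≤-trans; ≤-antisym; ≤-pred; <-irrefl; <-trans; <-asym; <-cmp
        ; <-≤-trans; <⇒≤; <⇒≢; <⇒≱; ≤⇒≯; ≰⇒>; m≤n⇒m≤1+n; m≤n⇒m<n∨m≡n; n≤1+n; n<1+n; 1+n≰n
        ; 1+n≢n; pred[n]≤n; m≤n+m; m<n+m; +-monoˡ-<; +-identityʳ; +-assoc; +-comm; *-zeroʳ
        ; *-distribˡ-+; suc-injective; ≡-irrelevant; <ᵇ⇒<; <⇒<ᵇ; ≤ᵇ⇒≤; ≤⇒≤ᵇ; ≡ᵇ⇒≡
        ; module ≤-Reasoning)
open import Data.Product using (Σ; ∃; ∃₂; ∃-syntax; _×_; _,_; proj₁; proj₂; swap)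
import Data.Product as Product
open import Data.Product.Function.NonDependent.Propositional using (_×-⇔_)
open import Data.Sum using (_⊎_; inj₁; inj₂)
import Data.Sum as Sum
open import Data.Sum.Function.Propositional using (_⊎-⇔_; _⊎-↔_)
open import Function using (_∘_; id; _⇔_; Equivalence; mk⇔; _↔_; mk↔ₛ′; Injective)
open import Function.Construct.Composition using (_⇔-∘_)
open import Function.Construct.Identity using (⇔-id)
open import Function.Construct.Symmetry using (⇔-sym)
open import Function.Properties.Inverse using (↔-trans; ↔-sym)
open import Relation.Binary using (DecidableEquality)
open import Relation.Binary.Definitions using (tri<; tri≈; tri>)
open import Relation.Binary.PropositionalEquality
  using (_≡_; _≢_; refl; sym; trans; cong; cong₂; subst; subst₂; module ≡-Reasoning)
open import Relation.Nullary using (¬_; yes; no; ¬?; contradiction)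
open import Relation.Nullary.Decidable using (toWitness; fromWitness)
open import Relation.Unary using (Pred; Decidable)
open import Relation.Unary.Properties using (_∩?_)

open import Defs

private variable
  ℓ ℓ′ p q : Level
  a b c i j u v : ℕ
  w : List ℕ

module _ {A : Set ℓ} {P : Pred A p} {Q : Pred A q} (P? : Decidable P) (Q? : Decidable Q) where

  filter-filter : ∀ xs → filter P? (filter Q? xs) ≡ filter (P? ∩? Q?) xs
  filter-filter [] = refl
  filter-filter (x ∷ xs) with Q? x
  ... | no _ with P? x
  ...   | yes _ = filter-filter xs
  ...   | no _  = filter-filter xs
  filter-filter (x ∷ xs) | yes _ with P? x
  ...   | yes _ = cong (x ∷_) (filter-filter xs)
  ...   | no _  = filter-filter xs

  filter-absorb : (∀ {x} → P x → Q x) → ∀ xs → filter P? (filter Q? xs) ≡ filter P? xs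
  filter-absorb P⇒Q xs =
    trans (filter-filter xs) (filter-≐ (P? ∩? Q?) P? (proj₁ , λ px → px , P⇒Q px) xs)

filter-comm : {A : Set ℓ} {P : Pred A p} {Q : Pred A q} (P? : Decidable P) (Q? : Decidable Q) →
              ∀ xs → filter P? (filter Q? xs) ≡ filter Q? (filter P? xs)
filter-comm P? Q? xs = begin
  filter P? (filter Q? xs)  ≡⟨ filter-filter P? Q? xs ⟩
  filter (P? ∩? Q?) xs      ≡⟨ filter-≐ (P? ∩? Q?) (Q? ∩? P?) (swap , swap) xs ⟩
  filter (Q? ∩? P?) xs      ≡⟨ filter-filter Q? P? xs ⟨
  filter Q? (filter P? xs)  ∎
  where open ≡-Reasoning

module _ {A : Set ℓ} (_≟ₐ_ : DecidableEquality A) where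

  deduplicate-filter : {P : Pred A p} (P? : Decidable P) →
                       ∀ xs → deduplicate _≟ₐ_ (filter P? xs) ≡ filter P? (deduplicate _≟ₐ_ xs)
  deduplicate-filter P? [] = refl
  deduplicate-filter {P = P} P? (x ∷ xs) with P? x
  ... | yes _ = cong (x ∷_) (trans (cong (filter (¬? ∘ (x ≟ₐ_))) (deduplicate-filter P? xs))
                                   (filter-comm (¬? ∘ (x ≟ₐ_)) P? (deduplicate _≟ₐ_ xs)))
  ... | no ¬px = trans (deduplicate-filter P? xs)
                       (sym (filter-absorb P? (¬? ∘ (x ≟ₐ_)) P⇒x≢ (deduplicate _≟ₐ_ xs)))
    where
    P⇒x≢ : ∀ {y} → P y → ¬ x ≡ y
    P⇒x≢ py refl = ¬px py

filter-map : {A : Set ℓ} {B : Set ℓ′} {P : Pred B p} {Q : Pred A q} →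
             (P? : Decidable P) (Q? : Decidable Q) (f : A → B) → (∀ x → P (f x) ⇔ Q x) →
             ∀ xs → filter P? (map f xs) ≡ map f (filter Q? xs)
filter-map P? Q? f P⇔Q [] = refl
filter-map P? Q? f P⇔Q (x ∷ xs) with P? (f x) | Q? x
... | yes _  | yes _ = cong (f x ∷_) (filter-map P? Q? f P⇔Q xs)
... | no _   | no _  = filter-map P? Q? f P⇔Q xs
... | yes p  | no ¬q = contradiction (Equivalence.to (P⇔Q x) p) ¬q
... | no ¬p  | yes q = contradiction (Equivalence.from (P⇔Q x) q) ¬p

deduplicate-map : {A : Set ℓ} {B : Set ℓ′} (_≟ₐ_ : DecidableEquality A) (_≟ᵦ_ : DecidableEquality B) →
                  {f : A → B} → Injective _≡_ _≡_ f →
                  ∀ xs → deduplicate _≟ᵦ_ (map f xs) ≡ map f (deduplicate _≟ₐ_ xs)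
deduplicate-map _≟ₐ_ _≟ᵦ_ f-inj [] = refl
deduplicate-map _≟ₐ_ _≟ᵦ_ {f} f-inj (x ∷ xs) = cong (f x ∷_)
  (trans (cong (filter (¬? ∘ (f x ≟ᵦ_))) (deduplicate-map _≟ₐ_ _≟ᵦ_ f-inj xs))
         (filter-map (¬? ∘ (f x ≟ᵦ_)) (¬? ∘ (x ≟ₐ_)) f ≢⇔≢ (deduplicate _≟ₐ_ xs)))
  where
  ≢⇔≢ : ∀ y → (¬ f x ≡ f y) ⇔ (¬ x ≡ y)
  ≢⇔≢ y = mk⇔ (λ fx≢fy x≡y → fx≢fy (cong f x≡y)) (λ x≢y fx≡fy → x≢y (f-inj fx≡fy))

-- red w is definitionally map (rank w) w.
rank : List ℕ → ℕ → ℕ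
rank w a = length (deduplicate _≟_ (filter (_<? a) w))

rank-filter : ∀ w u → rank w u ≡ length (filter (_<? u) (deduplicate _≟_ w))
rank-filter w u = cong length (deduplicate-filter _≟_ (_<? u) w)

rank-below : ∀ w → u ≤ v → rank w u ≡ length (filter (_<? u) (filter (_<? v) (deduplicate _≟_ w)))
rank-below {u} {v} w u≤v = trans (rank-filter w u)
  (cong length (sym (filter-absorb (_<? u) (_<? v) (λ x<u → <-≤-trans x<u u≤v) (deduplicate _≟_ w))))

rank-mono : ∀ w → u ≤ v → rank w u ≤ rank w v
rank-mono {u} {v} w u≤v = begin
  rank w u                                     ≡⟨ rank-below w u≤v ⟩
  length (filter (_<? u) (filter (_<? v) ws))  ≤⟨ length-filter (_<? u) (filter (_<? v) ws) ⟩
  length (filter (_<? v) ws)                   ≡⟨ rank-filter w v ⟨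
  rank w v                                     ∎
  where
  open ≤-Reasoning
  ws = deduplicate _≟_ w

rank-strict : ∀ w → u ∈ w → u < v → rank w u < rank w v
rank-strict {u} {v} w u∈w u<v = begin-strict
  rank w u                                     ≡⟨ rank-below w (<⇒≤ u<v) ⟩
  length (filter (_<? u) (filter (_<? v) ws))  <⟨ filter-notAll (_<? u) (filter (_<? v) ws) u≮u ⟩
  length (filter (_<? v) ws)                   ≡⟨ rank-filter w v ⟨
  rank w v                                     ∎
  where
  open ≤-Reasoning
  ws = deduplicate _≟_ w
  u≮u = Any.map (λ { refl → <-irrefl refl }) (∈-filter⁺ (_<? v) (∈-deduplicate⁺ _≟_ u∈w) u<v)

rank-reflects-< : ∀ w → rank w u < rank w v → u < v
rank-reflects-< {u} {v} w lt with <-cmp u v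
... | tri< u<v _ _ = u<v
... | tri≈ _ refl _ = contradiction lt (<-irrefl refl)
... | tri> _ _ v<u = contradiction lt (≤⇒≯ (rank-mono w (<⇒≤ v<u)))

rank-injective : ∀ w → u ∈ w → v ∈ w → rank w u ≡ rank w v → u ≡ v
rank-injective {u} {v} w u∈w v∈w eq with <-cmp u v
... | tri< u<v _ _ = contradiction eq (<⇒≢ (rank-strict w u∈w u<v))
... | tri≈ _ u≡v _ = u≡v
... | tri> _ _ v<u = contradiction (sym eq) (<⇒≢ (rank-strict w v∈w v<u))

module _ {f : ℕ → ℕ} (f-mono : ∀ {i j} → i < j → f i < f j) where

  private
    f-reflects-< : f i < f j → i < j
    f-reflects-< {i} {j} lt with <-cmp i j
    ... | tri< i<j _ _ = i<j
    ... | tri≈ _ refl _ = contradiction lt (<-irrefl refl)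
    ... | tri> _ _ j<i = contradiction (f-mono j<i) (<-asym lt)

    f-injective : f i ≡ f j → i ≡ j
    f-injective {i} {j} eq with <-cmp i j
    ... | tri< i<j _ _ = contradiction eq (<⇒≢ (f-mono i<j))
    ... | tri≈ _ i≡j _ = i≡j
    ... | tri> _ _ j<i = contradiction (sym eq) (<⇒≢ (f-mono j<i))

  rank-map : ∀ w u → rank (map f w) (f u) ≡ rank w u
  rank-map w u = begin
    length (deduplicate _≟_ (filter (_<? f u) (map f w)))
      ≡⟨ cong (length ∘ deduplicate _≟_) (filter-map (_<? f u) (_<? u) f (λ _ → mk⇔ f-reflects-< f-mono) w) ⟩
    length (deduplicate _≟_ (map f (filter (_<? u) w)))
      ≡⟨ cong length (deduplicate-map _≟_ _≟_ f-injective (filter (_<? u) w)) ⟩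
    length (map f (deduplicate _≟_ (filter (_<? u) w)))
      ≡⟨ length-map f (deduplicate _≟_ (filter (_<? u) w)) ⟩
    rank w u
      ∎
    where open ≡-Reasoning

  red-map : ∀ w → red (map f w) ≡ red w
  red-map w = trans (sym (map-∘ w)) (map-cong (rank-map w) w)

-- A strictly monotone map sending 0, 1, 2 to a, b, c: every occurrence is an image of its pattern.
spread : ℕ → ℕ → ℕ → ℕ → ℕ
spread a b c 0 = a
spread a b c 1 = b
spread a b c (suc (suc i)) = i ℕ.+ c

spread-mono : a < b → b < c → i < j → spread a b c i < spread a b c j
spread-mono {i = 0} {j = 1} a<b b<c _ = a<b
spread-mono {c = c} {i = 0} {j = suc (suc j)} a<b b<c _ = <-≤-trans (<-trans a<b b<c) (m≤n+m c j)
spread-mono {c = c} {i = 1} {j = suc (suc j)} a<b b<c _ = <-≤-trans b<c (m≤n+m c j)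
spread-mono {c = c} {i = suc (suc i)} {j = suc (suc j)} a<b b<c (s<s (s<s i<j)) = +-monoˡ-< c i<j
spread-mono {i = 1} {j = 1} _ _ (s<s ())
spread-mono {i = suc (suc i)} {j = 1} _ _ (s<s ())

-- Occurrences of the patterns

data Occurrence : List ℕ → Set where
  occ0101 : a < b → Occurrence (a ∷ b ∷ a ∷ b ∷ [])
  occ0112 : a < b → b < c → Occurrence (a ∷ b ∷ b ∷ c ∷ [])
  occ0120 : a < b → b < c → Occurrence (a ∷ b ∷ c ∷ a ∷ [])

Occurrence⇒red∈P₃ : ∀ {s} → Occurrence s → red s ∈ P₃
Occurrence⇒red∈P₃ (occ0101 {b = b} a<b) = here (red-map (spread-mono a<b (n<1+n b)) (0 ∷ 1 ∷ 0 ∷ 1 ∷ []))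
Occurrence⇒red∈P₃ (occ0112 a<b b<c) = there (here (red-map (spread-mono a<b b<c) (0 ∷ 1 ∷ 1 ∷ 2 ∷ [])))
Occurrence⇒red∈P₃ (occ0120 a<b b<c) =
  there (there (here (red-map (spread-mono a<b b<c) (0 ∷ 1 ∷ 2 ∷ 0 ∷ []))))

private
  ranks : ∀ a b c d {i j k l} → red (a ∷ b ∷ c ∷ d ∷ []) ≡ i ∷ j ∷ k ∷ l ∷ [] →
          let w = a ∷ b ∷ c ∷ d ∷ [] in
          rank w a ≡ i × rank w b ≡ j × rank w c ≡ k × rank w d ≡ l
  ranks a b c d refl = refl , refl , refl , refl

  ranked-< : ∀ w → rank w u ≡ i → rank w v ≡ j → i < j → u < v
  ranked-< w refl refl = rank-reflects-< w

  ranked-≡ : ∀ w → u ∈ w → v ∈ w → rank w u ≡ i → rank w v ≡ i → u ≡ v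
  ranked-≡ w u∈w v∈w refl eq = rank-injective w u∈w v∈w (sym eq)

  length-red∈P₃ : ∀ s → red s ∈ P₃ → length s ≡ 4
  length-red∈P₃ s r = trans (sym (length-map (rank s) s)) (length-P₃ r)
    where
    length-P₃ : ∀ {p} → p ∈ P₃ → length p ≡ 4
    length-P₃ (here refl) = refl
    length-P₃ (there (here refl)) = refl
    length-P₃ (there (there (here refl))) = refl

red∈P₃⇒Occurrence : ∀ s → red s ∈ P₃ → Occurrence s
red∈P₃⇒Occurrence s@(a ∷ b ∷ c ∷ d ∷ []) (here e) with ranks a b c d e
... | ra , rb , rc , rd = subst₂ (λ c d → Occurrence (a ∷ b ∷ c ∷ d ∷ []))
  (ranked-≡ s (here refl) (there (there (here refl))) ra rc)
  (ranked-≡ s (there (here refl)) (there (there (there (here refl)))) rb rd)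
  (occ0101 (ranked-< s ra rb z<s))
red∈P₃⇒Occurrence s@(a ∷ b ∷ c ∷ d ∷ []) (there (here e)) with ranks a b c d e
... | ra , rb , rc , rd = subst (λ c → Occurrence (a ∷ b ∷ c ∷ d ∷ []))
  (ranked-≡ s (there (here refl)) (there (there (here refl))) rb rc)
  (occ0112 (ranked-< s ra rb z<s) (ranked-< s rb rd (s<s z<s)))
red∈P₃⇒Occurrence s@(a ∷ b ∷ c ∷ d ∷ []) (there (there (here e))) with ranks a b c d e
... | ra , rb , rc , rd = subst (λ d → Occurrence (a ∷ b ∷ c ∷ d ∷ []))
  (ranked-≡ s (here refl) (there (there (there (here refl)))) ra rd)
  (occ0120 (ranked-< s ra rb z<s) (ranked-< s rb rc (s<s z<s)))
red∈P₃⇒Occurrence s@[] r = contradiction (length-red∈P₃ s r) λ ()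
red∈P₃⇒Occurrence s@(_ ∷ []) r = contradiction (length-red∈P₃ s r) λ ()
red∈P₃⇒Occurrence s@(_ ∷ _ ∷ []) r = contradiction (length-red∈P₃ s r) λ ()
red∈P₃⇒Occurrence s@(_ ∷ _ ∷ _ ∷ []) r = contradiction (length-red∈P₃ s r) λ ()
red∈P₃⇒Occurrence s@(_ ∷ _ ∷ _ ∷ _ ∷ _ ∷ _) r = contradiction (length-red∈P₃ s r) λ ()

HasSubseq : (List ℕ → Set) → List ℕ → Set
HasSubseq R X = ∃[ s ] s ⊆ X × R s

∈-subseqsOfLength⁺ : ∀ {s X} → s ⊆ X → s ∈ subseqsOfLength (length s) X
∈-subseqsOfLength⁺ {[]} _ = here refl
∈-subseqsOfLength⁺ {a ∷ s} (skip y τ) =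
  ∈-++⁺ʳ (map (y ∷_) (subseqsOfLength (length s) _)) (∈-subseqsOfLength⁺ τ)
∈-subseqsOfLength⁺ {a ∷ s} (refl ∷ τ) =
  ∈-++⁺ˡ (∈-map⁺ (a ∷_) (∈-subseqsOfLength⁺ τ))

∈-subseqsOfLength⁻ : ∀ k X {s} → s ∈ subseqsOfLength k X → s ⊆ X
∈-subseqsOfLength⁻ zero X (here refl) = minimum X
∈-subseqsOfLength⁻ (suc k) (y ∷ X) s∈ with ∈-++⁻ (map (y ∷_) (subseqsOfLength k X)) s∈
... | inj₁ s∈ʸ with ∈-map⁻ (y ∷_) s∈ʸ
...   | _ , s′∈ , refl = refl ∷ ∈-subseqsOfLength⁻ k X s′∈
∈-subseqsOfLength⁻ (suc k) (y ∷ X) s∈ | inj₂ s∈′ =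
  skip y (∈-subseqsOfLength⁻ (suc k) X s∈′)

T-contains : ∀ p X → T (contains p X) ⇔ HasSubseq (λ s → red s ≡ p) X
T-contains p X = mk⇔ to from
  where
  to : T (contains p X) → HasSubseq (λ s → red s ≡ p) X
  to t with s , s∈ , r ← find (any⁻ _ _ t) =
    s , ∈-subseqsOfLength⁻ (length p) X s∈ , toWitness r
  from : HasSubseq (λ s → red s ≡ p) X → T (contains p X)
  from (s , τ , refl) = any⁺ _ (lose s∈ (fromWitness refl))
    where
    s∈ = subst (λ k → s ∈ subseqsOfLength k X) (sym (length-map (rank s) s)) (∈-subseqsOfLength⁺ τ)

T-avoids : ∀ p X → T (avoids p X) ⇔ (¬ T (contains p X))
T-avoids p X with contains p X
... | true  = mk⇔ (λ ()) (λ ¬t → ¬t _)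
... | false = mk⇔ (λ _ ()) (λ _ → _)

T-avoidsAll : ∀ ps X → T (avoidsAll ps X) ⇔ (¬ HasSubseq (λ s → red s ∈ ps) X)
T-avoidsAll [] X = mk⇔ (λ { _ (_ , _ , ()) }) (λ _ → _)
T-avoidsAll (p ∷ ps) X = mk⇔ to from
  where
  open Equivalence using () renaming (to to ⇒; from to ⇐)
  to : T (avoids p X ∧ avoidsAll ps X) → ¬ HasSubseq (λ s → red s ∈ p ∷ ps) X
  to t (s , τ , here e) = ⇒ (T-avoids p X) (proj₁ (⇒ T-∧ t)) (⇐ (T-contains p X) (s , τ , e))
  to t (s , τ , there r) = ⇒ (T-avoidsAll ps X) (proj₂ (⇒ T-∧ t)) (s , τ , r)
  from : ¬ HasSubseq (λ s → red s ∈ p ∷ ps) X → T (avoids p X ∧ avoidsAll ps X)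
  from ¬occ = ⇐ T-∧
    ( ⇐ (T-avoids p X) (λ t → let s , τ , e = ⇒ (T-contains p X) t in ¬occ (s , τ , here e))
    , ⇐ (T-avoidsAll ps X) (λ { (s , τ , r) → ¬occ (s , τ , there r) }))

avoidsAll-P₃ : ∀ X → T (avoidsAll P₃ X) ⇔ (¬ HasSubseq Occurrence X)
avoidsAll-P₃ X = mk⇔
  (λ t (s , τ , o) → Equivalence.to (T-avoidsAll P₃ X) t (s , τ , Occurrence⇒red∈P₃ o))
  (λ ¬occ → Equivalence.from (T-avoidsAll P₃ X) (λ (s , τ , r) → ¬occ (s , τ , red∈P₃⇒Occurrence s r)))

⊆-∷ʳ⁻ : {A : Set ℓ} (X : List A) {s : List A} {y : A} →
        s ⊆ X ∷ʳ y → s ⊆ X ⊎ ∃[ s′ ] s ≡ s′ ∷ʳ y × s′ ⊆ X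
⊆-∷ʳ⁻ [] (skip _ τ) = inj₁ τ
⊆-∷ʳ⁻ [] (refl ∷ []) = inj₂ ([] , refl , [])
⊆-∷ʳ⁻ (x ∷ X) (skip _ τ) = Sum.map (skip x) (Product.map₂ (Product.map₂ (skip x))) (⊆-∷ʳ⁻ X τ)
⊆-∷ʳ⁻ (x ∷ X) (refl ∷ τ) with ⊆-∷ʳ⁻ X τ
... | inj₁ τ′ = inj₁ (refl ∷ τ′)
... | inj₂ (s′ , refl , τ′) = inj₂ (x ∷ s′ , refl , refl ∷ τ′)

HasSubseq-∷ʳ : ∀ {R X y} → HasSubseq R (X ∷ʳ y) ⇔ (HasSubseq R X ⊎ HasSubseq (R ∘ (_∷ʳ y)) X)
HasSubseq-∷ʳ {R} {X} {y} = mk⇔ to from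
  where
  to : HasSubseq R (X ∷ʳ y) → HasSubseq R X ⊎ HasSubseq (R ∘ (_∷ʳ y)) X
  to (s , τ , r) with ⊆-∷ʳ⁻ X τ
  ... | inj₁ τ′ = inj₁ (s , τ′ , r)
  ... | inj₂ (s′ , refl , τ′) = inj₂ (s′ , τ′ , r)
  from : HasSubseq R X ⊎ HasSubseq (R ∘ (_∷ʳ y)) X → HasSubseq R (X ∷ʳ y)
  from (inj₁ (s , τ , r)) = s , ++⁺ʳ [ y ] τ , r
  from (inj₂ (s , τ , r)) = s ∷ʳ y , ++⁺ τ ⊆-refl , r

Forbidden : List ℕ → ℕ → Set
Forbidden X y = HasSubseq (λ s → Occurrence (s ∷ʳ y)) X

-- The value at [] is arbitrary: lastOf is only applied to nonempty words.
lastOf : List ℕ → ℕ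
lastOf [] = 0
lastOf (x ∷ []) = x
lastOf (_ ∷ y ∷ ys) = lastOf (y ∷ ys)

lastOf-∷ʳ : ∀ X y → lastOf (X ∷ʳ y) ≡ y
lastOf-∷ʳ [] y = refl
lastOf-∷ʳ (x ∷ []) y = refl
lastOf-∷ʳ (x ∷ z ∷ zs) y = lastOf-∷ʳ (z ∷ zs) y

lastOf-∈ : ∀ x xs → lastOf (x ∷ xs) ∈ x ∷ xs
lastOf-∈ x [] = here refl
lastOf-∈ x (z ∷ zs) = there (lastOf-∈ z zs)

asc-∷ʳ : ∀ x xs y → asc (x ∷ xs ∷ʳ y) ≡ asc (x ∷ xs) ℕ.+ (if lastOf (x ∷ xs) <ᵇ y then 1 else 0)
asc-∷ʳ x [] y = +-identityʳ _
asc-∷ʳ x (z ∷ zs) y = trans (cong ((if x <ᵇ z then 1 else 0) ℕ.+_) (asc-∷ʳ z zs y))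
                            (sym (+-assoc (if x <ᵇ z then 1 else 0) (asc (z ∷ zs)) _))

asc-∷ʳ-≤ : ∀ x xs {y} → y ≤ lastOf (x ∷ xs) → asc (x ∷ xs ∷ʳ y) ≡ asc (x ∷ xs)
asc-∷ʳ-≤ x xs {y} y≤l with lastOf (x ∷ xs) <ᵇ y in l<ᵇy | asc-∷ʳ x xs y
... | false | eq = trans eq (+-identityʳ _)
... | true  | _  = contradiction (<ᵇ⇒< _ _ (subst T (sym l<ᵇy) _)) (≤⇒≯ y≤l)

asc-∷ʳ-< : ∀ x xs {y} → lastOf (x ∷ xs) < y → asc (x ∷ xs ∷ʳ y) ≡ suc (asc (x ∷ xs))
asc-∷ʳ-< x xs {y} l<y with lastOf (x ∷ xs) <ᵇ y in l<ᵇy | asc-∷ʳ x xs y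
... | true  | eq = trans eq (+-comm _ 1)
... | false | _  = contradiction (subst T l<ᵇy (<⇒<ᵇ l<y)) λ ()

checkFrom-∷ʳ : ∀ pre rest y →
               checkFrom pre (rest ∷ʳ y) ≡ checkFrom pre rest ∧ (y ≤ᵇ suc (asc (pre ++ rest)))
checkFrom-∷ʳ pre [] y rewrite ++-identityʳ pre = ∧-identityʳ _
checkFrom-∷ʳ pre (z ∷ rest) y
  rewrite checkFrom-∷ʳ (pre ++ [ z ]) rest y | ++-assoc pre [ z ] rest =
  sym (∧-assoc (z ≤ᵇ suc (asc pre)) (checkFrom (pre ++ [ z ]) rest) _)

isAscentSeq-∷ʳ : ∀ x xs y →
                 T (isAscentSeq (x ∷ xs ∷ʳ y)) ⇔ (T (isAscentSeq (x ∷ xs)) × y ≤ suc (asc (x ∷ xs)))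
isAscentSeq-∷ʳ x xs y
  rewrite checkFrom-∷ʳ [ x ] xs y
        | sym (∧-assoc (x ≡ᵇ 0) (checkFrom [ x ] xs) (y ≤ᵇ suc (asc (x ∷ xs)))) =
  (⇔-id _ ×-⇔ mk⇔ (≤ᵇ⇒≤ y _) ≤⇒≤ᵇ) ⇔-∘ T-∧

isAscentSeq-head : ∀ {x xs} → T (isAscentSeq (x ∷ xs)) → x ≡ 0
isAscentSeq-head {x} t = ≡ᵇ⇒≡ x 0 (proj₁ (Equivalence.to T-∧ t))

Avoider : List ℕ → Set
Avoider X = T (isAscentSeq X) × ¬ HasSubseq Occurrence X

avoider⇔ : ∀ X → T (isAscentSeq X ∧ avoidsAll P₃ X) ⇔ Avoider X
avoider⇔ X = (⇔-id _ ×-⇔ avoidsAll-P₃ X) ⇔-∘ T-∧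

avoider-∷ʳ⁻ : ∀ {x xs y} → Avoider (x ∷ xs ∷ʳ y) →
              Avoider (x ∷ xs) × y ≤ suc (asc (x ∷ xs)) × ¬ Forbidden (x ∷ xs) y
avoider-∷ʳ⁻ {x} {xs} {y} (ascent , free) with Equivalence.to (isAscentSeq-∷ʳ x xs y) ascent
... | ascent′ , y≤ = (ascent′ , free ∘ extended ∘ inj₁) , y≤ , free ∘ extended ∘ inj₂
  where extended = Equivalence.from HasSubseq-∷ʳ

-- Saturated avoiders

record Saturated (k : ℕ) (X : List ℕ) : Set where
  field
    ascent  : T (isAscentSeq X)
    asc≡    : asc X ≡ k
    P₃-free : ¬ HasSubseq Occurrence X
    bounded : ∀ {u} → u ∈ X → u ≤ k
    covers  : ∀ {u} → u ≤ k → u ∈ X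
    pairs   : ∀ {u v} → u < v → v ≤ k → u ∷ v ∷ [] ⊆ X

module _ {k x xs} (sat : Saturated k (x ∷ xs)) where
  open Saturated sat

  private
    X = x ∷ xs

    P₃-free-∷ʳ : ∀ {y} → ¬ Forbidden X y → ¬ HasSubseq Occurrence (X ∷ʳ y)
    P₃-free-∷ʳ ¬f = Sum.[ P₃-free , ¬f ] ∘ Equivalence.to HasSubseq-∷ʳ

    lastOf≤ : lastOf X ≤ k
    lastOf≤ = bounded (lastOf-∈ x xs)

  saturated-∷ʳ : ∀ {y} → y ≤ lastOf X → ¬ Forbidden X y → Saturated k (X ∷ʳ y)
  saturated-∷ʳ {y} y≤l ¬f = record
    { ascent  = Equivalence.from (isAscentSeq-∷ʳ x xs y)
                  (ascent , subst (λ h → y ≤ suc h) (sym asc≡) (m≤n⇒m≤1+n y≤k))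
    ; asc≡    = trans (asc-∷ʳ-≤ x xs y≤l) asc≡
    ; P₃-free = P₃-free-∷ʳ ¬f
    ; bounded = Sum.[ bounded , (λ { (here refl) → y≤k }) ] ∘ ∈-++⁻ X
    ; covers  = ∈-++⁺ˡ ∘ covers
    ; pairs   = λ u<v v≤k → ++⁺ʳ [ y ] (pairs u<v v≤k)
    }
    where y≤k = ≤-trans y≤l lastOf≤

  saturated-∷ʳ-suc : ¬ Forbidden X (suc k) → Saturated (suc k) (X ∷ʳ suc k)
  saturated-∷ʳ-suc ¬f = record
    { ascent  = Equivalence.from (isAscentSeq-∷ʳ x xs (suc k)) (ascent , s≤s (≤-reflexive (sym asc≡)))
    ; asc≡    = trans (asc-∷ʳ-< x xs (s≤s lastOf≤)) (cong suc asc≡)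
    ; P₃-free = P₃-free-∷ʳ ¬f
    ; bounded = Sum.[ m≤n⇒m≤1+n ∘ bounded , (λ { (here refl) → ≤-refl }) ] ∘ ∈-++⁻ X
    ; covers  = covers′
    ; pairs   = pairs′
    }
    where
    covers′ : ∀ {u} → u ≤ suc k → u ∈ X ∷ʳ suc k
    covers′ u≤1+k with m≤n⇒m<n∨m≡n u≤1+k
    ... | inj₁ u<1+k = ∈-++⁺ˡ (covers (≤-pred u<1+k))
    ... | inj₂ refl  = ∈-++⁺ʳ X (here refl)
    pairs′ : ∀ {u v} → u < v → v ≤ suc k → u ∷ v ∷ [] ⊆ X ∷ʳ suc k
    pairs′ u<v v≤1+k with m≤n⇒m<n∨m≡n v≤1+k
    ... | inj₁ v<1+k = ++⁺ʳ [ suc k ] (pairs u<v (≤-pred v<1+k))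
    ... | inj₂ refl  = ++⁺ (from∈ (covers (≤-pred u<v))) ⊆-refl

NewlyForbidden : ℕ → ℕ → ℕ → Set
NewlyForbidden k zero    a = 0 < a × a ≤ k
NewlyForbidden k (suc y) a = suc y < a ⊎ a < y

module _ {k X} (sat : Saturated k X) where
  open Saturated sat

  private
    Opens : ℕ → ℕ → Set
    Opens y a = HasSubseq (λ s → Occurrence (s ∷ʳ y ∷ʳ a)) X

    second∈ : u ∷ v ∷ [] ⊆ X → v ∈ X
    second∈ τ = lookup τ (there (here refl))

    opens-≤⁻ : ∀ y {a} → Opens y a → NewlyForbidden k y a
    opens-≤⁻ zero    (_ ∷ _ ∷ [] , τ , occ0101 0<a) = 0<a , bounded (second∈ τ)
    opens-≤⁻ (suc y) (_ ∷ _ ∷ [] , τ , occ0101 y<a) = inj₁ y<a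
    opens-≤⁻ (suc y) (_ ∷ _ ∷ [] , τ , occ0112 _ y<a) = inj₁ y<a
    opens-≤⁻ (suc y) (_ ∷ _ ∷ [] , τ , occ0120 a<v (s≤s v≤y)) = inj₂ (<-≤-trans a<v v≤y)
    opens-≤⁻ zero    (_ ∷ _ ∷ [] , τ , occ0112 () _)
    opens-≤⁻ zero    (_ ∷ _ ∷ [] , τ , occ0120 _ ())
    opens-≤⁻ _ ([] , _ , ())
    opens-≤⁻ _ (_ ∷ [] , _ , ())
    opens-≤⁻ _ (_ ∷ _ ∷ _ ∷ [] , _ , ())
    opens-≤⁻ _ (_ ∷ _ ∷ _ ∷ _ ∷ [] , _ , ())
    opens-≤⁻ _ (_ ∷ _ ∷ _ ∷ _ ∷ _ ∷ _ , _ , ())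

    opens-≤⁺ : ∀ y {a} → y ≤ k → NewlyForbidden k y a → Opens y a
    opens-≤⁺ zero    _   (0<a , a≤k) = _ , pairs 0<a a≤k , occ0101 0<a
    opens-≤⁺ (suc y) y<k (inj₁ y<a) = _ , pairs z<s y<k , occ0112 z<s y<a
    opens-≤⁺ (suc y) y<k (inj₂ a<y) =
      _ , pairs (n<1+n _) (≤-trans (m≤n⇒m≤1+n a<y) y<k) , occ0120 (n<1+n _) (s<s a<y)

    opens-suc⁻ : ∀ {a} → Opens (suc k) a → a < k
    opens-suc⁻ (_ ∷ _ ∷ [] , τ , occ0101 _) = contradiction (bounded (lookup τ (here refl))) 1+n≰n
    opens-suc⁻ (_ ∷ _ ∷ [] , τ , occ0112 _ _) = contradiction (bounded (second∈ τ)) 1+n≰n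
    opens-suc⁻ (_ ∷ _ ∷ [] , τ , occ0120 a<v (s≤s v≤k)) = <-≤-trans a<v v≤k
    opens-suc⁻ ([] , _ , ())
    opens-suc⁻ (_ ∷ [] , _ , ())
    opens-suc⁻ (_ ∷ _ ∷ _ ∷ [] , _ , ())
    opens-suc⁻ (_ ∷ _ ∷ _ ∷ _ ∷ [] , _ , ())
    opens-suc⁻ (_ ∷ _ ∷ _ ∷ _ ∷ _ ∷ _ , _ , ())

    opens-suc⁺ : ∀ {a} → a < k → Opens (suc k) a
    opens-suc⁺ a<k = _ , pairs (n<1+n _) a<k , occ0120 (n<1+n _) (s<s a<k)

  forbidden-∷ʳ : ∀ {y a} → y ≤ k → Forbidden (X ∷ʳ y) a ⇔ (Forbidden X a ⊎ NewlyForbidden k y a)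
  forbidden-∷ʳ {y} y≤k = (⇔-id _ ⊎-⇔ mk⇔ (opens-≤⁻ y) (opens-≤⁺ y y≤k)) ⇔-∘ HasSubseq-∷ʳ

  forbidden-∷ʳ-suc : ∀ {a} → Forbidden (X ∷ʳ suc k) a ⇔ (Forbidden X a ⊎ a < k)
  forbidden-∷ʳ-suc = (⇔-id _ ⊎-⇔ mk⇔ opens-suc⁻ opens-suc⁺) ⇔-∘ HasSubseq-∷ʳ

-- The shape automaton

-- The avoiders of each shape (x⁺ is a nonempty run of x, k the number of ascents):
--   Z  0⁺          A  0⁺1         B  0⁺10⁺        C  0⁺11⁺        D  0⁺11⁺0⁺
--   R₂ 0⁺10⁺2      P₂ 0⁺10⁺22⁺
--   R  0⁺12⋯k or 0⁺10⁺23⋯k (k ≥ 2),  P  R k⁺,  Q  R k* (k-1)⁺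
data Shape : Set where
  Z A B C D R₂ P₂ R P Q : Shape

data Move : Set where
  same down up : Move

data Step : Shape → Move → Shape → Set where
  Z-same  : Step Z same Z
  Z-up    : Step Z up A
  A-down  : Step A down B
  A-same  : Step A same C
  A-up    : Step A up R
  B-same  : Step B same B
  B-up    : Step B up R₂
  C-down  : Step C down D
  C-same  : Step C same C
  D-same  : Step D same D
  R₂-same : Step R₂ same P₂
  R₂-up   : Step R₂ up R
  P₂-same : Step P₂ same P₂
  R-down  : Step R down Q
  R-same  : Step R same P
  R-up    : Step R up R
  P-down  : Step P down Q
  P-same  : Step P same P
  Q-same  : Step Q same Q

HasHeight : Shape → ℕ → Set
HasHeight Z  k = k ≡ 0
HasHeight A  k = k ≡ 1
HasHeight B  k = k ≡ 1
HasHeight C  k = k ≡ 1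
HasHeight D  k = k ≡ 1
HasHeight R₂ k = k ≡ 2
HasHeight P₂ k = k ≡ 2
HasHeight R  k = 2 ≤ k
HasHeight P  k = 2 ≤ k
HasHeight Q  k = 2 ≤ k

lastLetter : Shape → ℕ → ℕ
lastLetter Z  _ = 0
lastLetter A  _ = 1
lastLetter B  _ = 0
lastLetter C  _ = 1
lastLetter D  _ = 0
lastLetter R₂ _ = 2
lastLetter P₂ _ = 2
lastLetter R  k = k
lastLetter P  k = k
lastLetter Q  k = pred k

Excluded : Shape → ℕ → ℕ → Set
Excluded Z  k a = ⊥
Excluded A  k a = ⊥
Excluded B  k a = a ≡ 1
Excluded C  k a = 2 ≤ a
Excluded D  k a = 1 ≤ a
Excluded R₂ k a = a ≤ 1
Excluded P₂ k a = a ≤ 1 ⊎ 3 ≤ a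
Excluded R  k a = 2 ℕ.+ a ≤ k
Excluded P  k a = 2 ℕ.+ a ≤ k ⊎ suc k ≤ a
Excluded Q  k a = 2 ℕ.+ a ≤ k ⊎ k ≤ a

letter : Move → Shape → ℕ → ℕ
letter same s k = lastLetter s k
letter down s k = pred (lastLetter s k)
letter up   s k = suc k

raise : Move → ℕ → ℕ
raise same k = k
raise down k = k
raise up   k = suc k

private variable
  s s′ s₁ s₂ : Shape
  m m′ : Move
  k : ℕ

step-height : HasHeight s k → Step s m s′ → HasHeight s′ (raise m k)
step-height refl Z-same  = refl
step-height refl Z-up    = refl
step-height refl A-down  = refl
step-height refl A-same  = refl
step-height refl A-up    = ≤-refl
step-height refl B-same  = refl
step-height refl B-up    = refl
step-height refl C-down  = refl
step-height refl C-same  = refl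
step-height refl D-same  = refl
step-height refl R₂-same = refl
step-height refl R₂-up   = s≤s (s≤s z≤n)
step-height refl P₂-same = refl
step-height 2≤k  R-down  = 2≤k
step-height 2≤k  R-same  = 2≤k
step-height 2≤k  R-up    = m≤n⇒m≤1+n 2≤k
step-height 2≤k  P-down  = 2≤k
step-height 2≤k  P-same  = 2≤k
step-height 2≤k  Q-same  = 2≤k

step-lastLetter : HasHeight s k → Step s m s′ → lastLetter s′ (raise m k) ≡ letter m s k
step-lastLetter refl Z-same  = refl
step-lastLetter refl Z-up    = refl
step-lastLetter _    A-down  = refl
step-lastLetter _    A-same  = refl
step-lastLetter _    A-up    = refl
step-lastLetter _    B-same  = refl
step-lastLetter refl B-up    = refl
step-lastLetter _    C-down  = refl
step-lastLetter _    C-same  = refl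
step-lastLetter _    D-same  = refl
step-lastLetter _    R₂-same = refl
step-lastLetter _    R₂-up   = refl
step-lastLetter _    P₂-same = refl
step-lastLetter _    R-down  = refl
step-lastLetter _    R-same  = refl
step-lastLetter _    R-up    = refl
step-lastLetter _    P-down  = refl
step-lastLetter _    P-same  = refl
step-lastLetter _    Q-same  = refl

private
  suc+≰ : ∀ n {k} → ¬ suc n ℕ.+ k ≤ k
  suc+≰ n {k} = <⇒≱ (m<n+m k z<s)

  ≢-pred : ∀ {n} → 0 < n → n ≢ pred n
  ≢-pred {suc n} _ = 1+n≢n

step-allowed : HasHeight s k → Step s m s′ → ¬ Excluded s k (letter m s k)
step-allowed refl Z-same  = λ ()
step-allowed refl Z-up    = λ ()
step-allowed refl A-down  = λ ()
step-allowed refl A-same  = λ ()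
step-allowed refl A-up    = λ ()
step-allowed refl B-same  = λ ()
step-allowed refl B-up    = λ ()
step-allowed refl C-down  = λ ()
step-allowed refl C-same  = suc+≰ 0
step-allowed refl D-same  = λ ()
step-allowed refl R₂-same = suc+≰ 0
step-allowed refl R₂-up   = suc+≰ 1
step-allowed refl P₂-same = Sum.[ suc+≰ 0 , suc+≰ 0 ]
step-allowed (s≤s (s≤s _)) R-down = suc+≰ 0
step-allowed _             R-same = suc+≰ 1
step-allowed _             R-up   = suc+≰ 2
step-allowed (s≤s (s≤s _)) P-down = Sum.[ suc+≰ 0 , suc+≰ 1 ]
step-allowed _             P-same = Sum.[ suc+≰ 1 , suc+≰ 0 ]
step-allowed (s≤s (s≤s _)) Q-same = Sum.[ suc+≰ 0 , suc+≰ 0 ]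

private
  absorbs : ∀ {X Y : Set} → (Y → X) → X ⇔ (X ⊎ Y)
  absorbs Y⇒X = mk⇔ inj₁ Sum.[ id , Y⇒X ]

excluded-same : HasHeight s k → Step s same s′ →
                ∀ a → Excluded s′ k a ⇔ (Excluded s k a ⊎ NewlyForbidden k (lastLetter s k) a)
excluded-same refl Z-same  a = mk⇔ (λ ()) Sum.[ (λ ()) , (λ { (s≤s _ , ()) }) ]
excluded-same refl A-same  a = mk⇔ (inj₂ ∘ inj₁) Sum.[ (λ ()) , Sum.[ id , (λ ()) ] ]
excluded-same refl B-same  a = absorbs λ { (s≤s z≤n , s≤s z≤n) → refl }
excluded-same refl C-same  a = absorbs Sum.[ id , (λ ()) ]
excluded-same refl D-same  a = absorbs proj₁
excluded-same refl R₂-same a =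
  mk⇔ Sum.[ inj₁ , inj₂ ∘ inj₁ ] Sum.[ inj₁ , Sum.[ inj₂ , inj₁ ∘ <⇒≤ ] ]
excluded-same refl P₂-same a = absorbs Sum.[ inj₂ , inj₁ ∘ <⇒≤ ]
excluded-same (s≤s (s≤s _)) R-same a =
  mk⇔ Sum.[ inj₁ , inj₂ ∘ inj₁ ] Sum.[ inj₁ , Sum.[ inj₂ , inj₁ ∘ s≤s ] ]
excluded-same (s≤s (s≤s _)) P-same a = absorbs Sum.[ inj₂ , inj₁ ∘ s≤s ]
excluded-same (s≤s (s≤s _)) Q-same a = absorbs Sum.[ inj₂ , inj₁ ∘ s≤s ∘ m≤n⇒m≤1+n ]

excluded-down : HasHeight s k → Step s down s′ →
                ∀ a → Excluded s′ k a ⇔ (Excluded s k a ⊎ NewlyForbidden k (pred (lastLetter s k)) a)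
excluded-down refl A-down a =
  mk⇔ (λ { refl → inj₂ (z<s , ≤-refl) }) Sum.[ (λ ()) , (λ { (s≤s z≤n , s≤s z≤n) → refl }) ]
excluded-down refl C-down a = mk⇔ to Sum.[ <⇒≤ , proj₁ ]
  where
  to : ∀ {a} → 1 ≤ a → 2 ≤ a ⊎ (0 < a × a ≤ 1)
  to {1}           _ = inj₂ (z<s , ≤-refl)
  to {suc (suc _)} _ = inj₁ (s≤s (s≤s z≤n))
excluded-down (s≤s (s≤s _)) R-down a =
  mk⇔ Sum.[ inj₁ , inj₂ ∘ inj₁ ] Sum.[ inj₁ , Sum.[ inj₂ , inj₁ ∘ s≤s ∘ m≤n⇒m≤1+n ] ]
excluded-down (s≤s (s≤s _)) P-down a =
  mk⇔ Sum.[ inj₁ ∘ inj₁ , inj₂ ∘ inj₁ ]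
      Sum.[ Sum.[ inj₁ , inj₂ ∘ <⇒≤ ] , Sum.[ inj₂ , inj₁ ∘ s≤s ∘ m≤n⇒m≤1+n ] ]

excluded-up : HasHeight s k → Step s up s′ →
              ∀ a → Excluded s′ (suc k) a ⇔ (Excluded s k a ⊎ a < k)
excluded-up refl Z-up  a = mk⇔ (λ ()) Sum.[ (λ ()) , (λ ()) ]
excluded-up refl A-up  a =
  mk⇔ (λ { (s≤s (s≤s a≤0)) → inj₂ (s≤s a≤0) }) Sum.[ (λ ()) , (λ { (s≤s a≤0) → s≤s (s≤s a≤0) }) ]
excluded-up refl B-up  a = mk⇔ to Sum.[ (λ { refl → ≤-refl }) , <⇒≤ ]
  where
  to : ∀ {a} → a ≤ 1 → a ≡ 1 ⊎ a < 1
  to {0}           _ = inj₂ z<s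
  to {1}           _ = inj₁ refl
  to {suc (suc _)} (s≤s ())
excluded-up refl R₂-up a =
  mk⇔ (λ { (s≤s (s≤s a≤1)) → inj₁ a≤1 }) Sum.[ s≤s ∘ s≤s , s≤s ∘ s≤s ∘ ≤-pred ]
excluded-up _    R-up  a = mk⇔ (λ { (s≤s a<k) → inj₂ a<k }) Sum.[ m≤n⇒m≤1+n , s≤s ]

down-positive : HasHeight s k → Step s down s′ → 0 < lastLetter s k
down-positive _       A-down = z<s
down-positive _       C-down = z<s
down-positive (s≤s _) R-down = z<s
down-positive (s≤s _) P-down = z<s

step-deterministic : (t : Step s m s₁) (t′ : Step s m s₂) →
                     _≡_ {A = Σ Shape (Step s m)} (s₁ , t) (s₂ , t′)
step-deterministic Z-same  Z-same  = refl
step-deterministic Z-up    Z-up    = refl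
step-deterministic A-down  A-down  = refl
step-deterministic A-same  A-same  = refl
step-deterministic A-up    A-up    = refl
step-deterministic B-same  B-same  = refl
step-deterministic B-up    B-up    = refl
step-deterministic C-down  C-down  = refl
step-deterministic C-same  C-same  = refl
step-deterministic D-same  D-same  = refl
step-deterministic R₂-same R₂-same = refl
step-deterministic R₂-up   R₂-up   = refl
step-deterministic P₂-same P₂-same = refl
step-deterministic R-down  R-down  = refl
step-deterministic R-same  R-same  = refl
step-deterministic R-up    R-up    = refl
step-deterministic P-down  P-down  = refl
step-deterministic P-same  P-same  = refl
step-deterministic Q-same  Q-same  = refl

Successor : Shape → ℕ → ℕ → Set
Successor s k y = ∃₂ λ m s′ → Step s m s′ × letter m s k ≡ y

private
  top-three : ∀ {j y} → y ≤ 3 ℕ.+ j → ¬ y ≤ j → y ≡ 1 ℕ.+ j ⊎ y ≡ 2 ℕ.+ j ⊎ y ≡ 3 ℕ.+ j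
  top-three y≤3+j y≰j with m≤n⇒m<n∨m≡n y≤3+j
  ... | inj₂ y≡3+j = inj₂ (inj₂ y≡3+j)
  ... | inj₁ y<3+j with m≤n⇒m<n∨m≡n (≤-pred y<3+j)
  ...   | inj₂ y≡2+j = inj₂ (inj₁ y≡2+j)
  ...   | inj₁ y<2+j = inj₁ (≤-antisym (≤-pred y<2+j) (≰⇒> y≰j))

classify : HasHeight s k → ∀ y → y ≤ suc k → ¬ Excluded s k y → Successor s k y
classify {Z}  refl 0 _ _ = same , Z , Z-same , refl
classify {Z}  refl 1 _ _ = up , A , Z-up , refl
classify {Z}  refl (suc (suc _)) (s≤s ()) _
classify {A}  refl 0 _ _ = down , B , A-down , refl
classify {A}  refl 1 _ _ = same , C , A-same , refl
classify {A}  refl 2 _ _ = up , R , A-up , refl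
classify {A}  refl (suc (suc (suc _))) (s≤s (s≤s ())) _
classify {B}  refl 0 _ _ = same , B , B-same , refl
classify {B}  refl 1 _ ¬ex = contradiction refl ¬ex
classify {B}  refl 2 _ _ = up , R₂ , B-up , refl
classify {B}  refl (suc (suc (suc _))) (s≤s (s≤s ())) _
classify {C}  refl 0 _ _ = down , D , C-down , refl
classify {C}  refl 1 _ _ = same , C , C-same , refl
classify {C}  refl (suc (suc _)) _ ¬ex = contradiction (s≤s (s≤s z≤n)) ¬ex
classify {D}  refl 0 _ _ = same , D , D-same , refl
classify {D}  refl (suc _) _ ¬ex = contradiction (s≤s z≤n) ¬ex
classify {R₂} refl 0 _ ¬ex = contradiction z≤n ¬ex
classify {R₂} refl 1 _ ¬ex = contradiction ≤-refl ¬ex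
classify {R₂} refl 2 _ _ = same , P₂ , R₂-same , refl
classify {R₂} refl 3 _ _ = up , R , R₂-up , refl
classify {R₂} refl (suc (suc (suc (suc _)))) (s≤s (s≤s (s≤s ()))) _
classify {P₂} refl 0 _ ¬ex = contradiction (inj₁ z≤n) ¬ex
classify {P₂} refl 1 _ ¬ex = contradiction (inj₁ ≤-refl) ¬ex
classify {P₂} refl 2 _ _ = same , P₂ , P₂-same , refl
classify {P₂} refl (suc (suc (suc _))) _ ¬ex = contradiction (inj₂ (s≤s (s≤s (s≤s z≤n)))) ¬ex
classify {R} (s≤s (s≤s _)) y y≤ ¬ex with top-three y≤ (¬ex ∘ s≤s ∘ s≤s)
... | inj₁ refl        = down , Q , R-down , refl
... | inj₂ (inj₁ refl) = same , P , R-same , refl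
... | inj₂ (inj₂ refl) = up , R , R-up , refl
classify {P} (s≤s (s≤s _)) y y≤ ¬ex with top-three y≤ (¬ex ∘ inj₁ ∘ s≤s ∘ s≤s)
... | inj₁ refl        = down , Q , P-down , refl
... | inj₂ (inj₁ refl) = same , P , P-same , refl
... | inj₂ (inj₂ refl) = contradiction (inj₂ ≤-refl) ¬ex
classify {Q} (s≤s (s≤s _)) y y≤ ¬ex with top-three y≤ (¬ex ∘ inj₁ ∘ s≤s ∘ s≤s)
... | inj₁ refl        = same , Q , Q-same , refl
... | inj₂ (inj₁ refl) = contradiction (inj₂ ≤-refl) ¬ex
... | inj₂ (inj₂ refl) = contradiction (inj₂ (n≤1+n _)) ¬ex

record OfShape (s : Shape) (k : ℕ) (X : List ℕ) : Set where
  field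
    saturated  : Saturated k X
    has-height : HasHeight s k
    ends       : lastOf X ≡ lastLetter s k
    forbidden  : ∀ a → Forbidden X a ⇔ Excluded s k a

open OfShape

lastLetter≤ : ∀ {x xs} → OfShape s k (x ∷ xs) → lastLetter s k ≤ k
lastLetter≤ {x = x} {xs} o = subst (_≤ _) (ends o) (Saturated.bounded (saturated o) (lastOf-∈ x xs))

private
  ⇔-update : ∀ {F F′ E E′ N : Set} → F′ ⇔ (F ⊎ N) → F ⇔ E → E′ ⇔ (E ⊎ N) → F′ ⇔ E′
  ⇔-update F′⇔ F⇔E E′⇔ = ⇔-sym E′⇔ ⇔-∘ ((F⇔E ⊎-⇔ ⇔-id _) ⇔-∘ F′⇔)

  ofShape-stay : ∀ {x xs y} → (o : OfShape s k (x ∷ xs)) → y ≤ lastLetter s k →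
                 HasHeight s′ k → lastLetter s′ k ≡ y → ¬ Excluded s k y →
                 (∀ a → Excluded s′ k a ⇔ (Excluded s k a ⊎ NewlyForbidden k y a)) →
                 OfShape s′ k (x ∷ xs ∷ʳ y)
  ofShape-stay {x = x} {xs} {y} o y≤ℓ h ℓ≡y ¬ex update = record
    { saturated  = saturated-∷ʳ (saturated o) (subst (y ≤_) (sym (ends o)) y≤ℓ)
                                (¬ex ∘ Equivalence.to (forbidden o y))
    ; has-height = h
    ; ends       = trans (lastOf-∷ʳ (x ∷ xs) y) (sym ℓ≡y)
    ; forbidden  = λ a → ⇔-update (forbidden-∷ʳ (saturated o) (≤-trans y≤ℓ (lastLetter≤ o)))
                                  (forbidden o a) (update a)
    }

ofShape-∷ʳ : ∀ {x xs} → OfShape s k (x ∷ xs) → Step s m s′ →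
             OfShape s′ (raise m k) (x ∷ xs ∷ʳ letter m s k)
ofShape-∷ʳ {m = same} o t = let h = has-height o in
  ofShape-stay o ≤-refl (step-height h t) (step-lastLetter h t) (step-allowed h t) (excluded-same h t)
ofShape-∷ʳ {m = down} o t = let h = has-height o in
  ofShape-stay o pred[n]≤n (step-height h t) (step-lastLetter h t) (step-allowed h t) (excluded-down h t)
ofShape-∷ʳ {s} {k} {up} {x = x} {xs} o t = record
  { saturated  = saturated-∷ʳ-suc (saturated o) (step-allowed h t ∘ Equivalence.to (forbidden o (suc k)))
  ; has-height = step-height h t
  ; ends       = trans (lastOf-∷ʳ (x ∷ xs) (suc k)) (sym (step-lastLetter h t))
  ; forbidden  = λ a → ⇔-update (forbidden-∷ʳ-suc (saturated o)) (forbidden o a) (excluded-up h t a)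
  }
  where h = has-height o

successor : ∀ {X y} → OfShape s k X → y ≤ suc (asc X) → ¬ Forbidden X y → Successor s k y
successor {y = y} o y≤ ¬f = classify (has-height o) y
  (subst (λ h → y ≤ suc h) (Saturated.asc≡ (saturated o)) y≤) (¬f ∘ Equivalence.from (forbidden o y))

private
  same≢down : HasHeight s k → Step s down s′ → lastLetter s k ≢ pred (lastLetter s k)
  same≢down h t = ≢-pred (down-positive h t)

  down≢up : ∀ {x xs} → OfShape s k (x ∷ xs) → pred (lastLetter s k) ≢ suc k
  down≢up o = <⇒≢ (s≤s (≤-trans pred[n]≤n (lastLetter≤ o)))

move-injective : ∀ {x xs} → OfShape s k (x ∷ xs) → Step s m s₁ → Step s m′ s₂ →
                 letter m s k ≡ letter m′ s k → m ≡ m′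
move-injective {m = same} {m′ = same} _ _ _ _  = refl
move-injective {m = down} {m′ = down} _ _ _ _  = refl
move-injective {m = up}   {m′ = up}   _ _ _ _  = refl
move-injective {m = same} {m′ = down} o _ t eq = contradiction eq (same≢down (has-height o) t)
move-injective {m = down} {m′ = same} o t _ eq = contradiction (sym eq) (same≢down (has-height o) t)
move-injective {m = same} {m′ = up}   o _ _ eq = contradiction eq (<⇒≢ (s≤s (lastLetter≤ o)))
move-injective {m = up}   {m′ = same} o _ _ eq = contradiction (sym eq) (<⇒≢ (s≤s (lastLetter≤ o)))
move-injective {m = down} {m′ = up}   o _ _ eq = contradiction eq (down≢up o)
move-injective {m = up}   {m′ = down} o _ _ eq = contradiction (sym eq) (down≢up o)

data Path : ℕ → Shape → Set where
  start : Path 0 Z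
  _▷_   : ∀ {n} → Path n s → Step s m s′ → Path (suc n) s′

height : ∀ {n} → Path n s → ℕ
height start = 0
height (_▷_ {m = m} p _) = raise m (height p)

letters : ∀ {n} → Path n s → List ℕ
letters start = []
letters (_▷_ {s = s} {m = m} p _) = letters p ∷ʳ letter m s (height p)

length-letters : ∀ {n} (p : Path n s) → length (letters p) ≡ n
length-letters start = refl
length-letters (p ▷ _) = trans (length-++ (letters p)) (trans (+-comm _ 1) (cong suc (length-letters p)))

start-ofShape : OfShape Z 0 (0 ∷ [])
start-ofShape = record
  { saturated  = record
    { ascent  = _
    ; asc≡    = refl
    ; P₃-free = λ { ([] , _ , ()) ; (_ ∷ [] , _ , ()) ; (_ ∷ _ ∷ _ , skip _ () , _) ; (_ ∷ _ ∷ _ , _ ∷ () , _) }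
    ; bounded = λ { (here refl) → z≤n }
    ; covers  = λ { z≤n → here refl }
    ; pairs   = λ { u<v z≤n → contradiction u<v λ () }
    }
  ; has-height = refl
  ; ends       = refl
  ; forbidden  = λ a → mk⇔
      (λ { ([] , _ , ()) ; (_ ∷ [] , _ , ()) ; (_ ∷ _ ∷ _ , skip _ () , _) ; (_ ∷ _ ∷ _ , _ ∷ () , _) })
      λ ()
  }

path-ofShape : ∀ {n} (p : Path n s) → OfShape s (height p) (0 ∷ letters p)
path-ofShape start = start-ofShape
path-ofShape (p ▷ t) = ofShape-∷ʳ (path-ofShape p) t

ofShape-avoider : ∀ {X} → OfShape s k X → Avoider X
ofShape-avoider o = Saturated.ascent (saturated o) , Saturated.P₃-free (saturated o)

letters-injective : ∀ {n} (p : Path n s₁) (q : Path n s₂) → letters p ≡ letters q →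
                    _≡_ {A = Σ Shape (Path n)} (s₁ , p) (s₂ , q)
letters-injective start start _ = refl
letters-injective (p ▷ t) (q ▷ t′) eq with ∷ʳ-injective (letters p) (letters q) eq
... | eq₁ , eq₂ with letters-injective p q eq₁
... | refl with move-injective (path-ofShape p) t t′ eq₂
... | refl with step-deterministic t t′
... | refl = refl

extend : ∀ {n} (p : Path n s) {y} → y ≤ suc (asc (0 ∷ letters p)) → ¬ Forbidden (0 ∷ letters p) y →
         ∃₂ λ s′ (q : Path (suc n) s′) → letters q ≡ letters p ∷ʳ y
extend p y≤ ¬f with successor (path-ofShape p) y≤ ¬f
... | _ , s′ , t , refl = s′ , p ▷ t , refl

∷ʳ-view : ∀ {n} (xs : List ℕ) → length xs ≡ suc n → ∃₂ λ ys y → xs ≡ ys ∷ʳ y × length ys ≡ n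
∷ʳ-view xs len with initLast xs
... | []       = contradiction len λ ()
... | ys ∷ʳ′ y = ys , y , refl , suc-injective (trans (trans (+-comm 1 _) (sym (length-++ ys))) len)

letters-surjective : ∀ n X → length X ≡ suc n → Avoider X → ∃₂ λ s (p : Path n s) → 0 ∷ letters p ≡ X
letters-surjective zero (x ∷ []) _ (ascent , _) =
  Z , start , cong [_] (sym (isAscentSeq-head {xs = []} ascent))
letters-surjective (suc n) X len v with ∷ʳ-view X len
... | x ∷ xs , y , refl , len′ with avoider-∷ʳ⁻ {x} {xs} {y} v
... | v′ , y≤ , ¬f with letters-surjective n (x ∷ xs) len′ v′
... | s , p , refl with extend p y≤ ¬f
... | s′ , q , eq = s′ , q , cong (0 ∷_) eq

𝒜-≡ : ∀ {n X Y l₁ l₂ v₁ v₂} → X ≡ Y → _≡_ {A = 𝒜 P₃ n} (X , l₁ , v₁) (Y , l₂ , v₂)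
𝒜-≡ {X = X} refl = cong₂ (λ l v → X , l , v) (≡-irrelevant _ _) (T-irrelevant _ _)

𝒜↔paths : ∀ n → 𝒜 P₃ (suc n) ↔ Σ Shape (Path n)
𝒜↔paths n = mk↔ₛ′ (Product.map₂ proj₁ ∘ path) word path∘word (λ x → 𝒜-≡ (proj₂ (proj₂ (path x))))
  where
  path : (x : 𝒜 P₃ (suc n)) → ∃₂ λ s (p : Path n s) → 0 ∷ letters p ≡ proj₁ x
  path (X , len , v) = letters-surjective n X len (Equivalence.to (avoider⇔ X) v)
  word : Σ Shape (Path n) → 𝒜 P₃ (suc n)
  word (s , p) = 0 ∷ letters p , cong suc (length-letters p) ,
                 Equivalence.from (avoider⇔ _) (ofShape-avoider (path-ofShape p))
  path∘word : ∀ sp → Product.map₂ proj₁ (path (word sp)) ≡ sp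
  path∘word (s , p) with path (word (s , p))
  ... | _ , q , eq = letters-injective q p (∷-injectiveʳ eq)

Σ↔Any : ∀ {I : Set} {F : I → Set} {is} (enum : ∀ i → i ∈ is) → (∀ {i} (i∈ : i ∈ is) → i∈ ≡ enum i) →
        Σ I F ↔ Any F is
Σ↔Any {F = F} {is} enum unique = ↔-trans (mk↔ₛ′ to from to∘from (λ _ → refl)) Any↔
  where
  to : Σ _ F → ∃ λ i → i ∈ is × F i
  to (i , x) = i , enum i , x
  from : (∃ λ i → i ∈ is × F i) → Σ _ F
  from (i , _ , x) = i , x
  to∘from : ∀ y → to (from y) ≡ y
  to∘from (i , i∈ , x) = cong (λ i∈ → i , i∈ , x) (sym (unique i∈))

Any↔Fin : ∀ {I : Set} {F : I → Set} {f : I → ℕ} → (∀ i → F i ↔ Fin (f i)) →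
          ∀ is → Any F is ↔ Fin (sum (map f is))
Any↔Fin F↔Fin [] = ↔-trans (↔-sym ⊥↔Any[]) (↔-sym 0↔⊥)
Any↔Fin F↔Fin (i ∷ is) =
  ↔-trans (↔-sym (∷↔ _)) (↔-trans (F↔Fin i ⊎-↔ Any↔Fin F↔Fin is) (↔-sym +↔⊎))

shapes : List Shape
shapes = Z ∷ A ∷ B ∷ C ∷ D ∷ R₂ ∷ P₂ ∷ R ∷ P ∷ Q ∷ []

∈-shapes : ∀ s → s ∈ shapes
∈-shapes Z  = here refl
∈-shapes A  = there (here refl)
∈-shapes B  = there (there (here refl))
∈-shapes C  = there (there (there (here refl)))
∈-shapes D  = there (there (there (there (here refl))))
∈-shapes R₂ = there (there (there (there (there (here refl)))))
∈-shapes P₂ = there (there (there (there (there (there (here refl))))))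
∈-shapes R  = there (there (there (there (there (there (there (here refl)))))))
∈-shapes P  = there (there (there (there (there (there (there (there (here refl))))))))
∈-shapes Q  = there (there (there (there (there (there (there (there (there (here refl)))))))))

∈-shapes-unique : (s∈ : s ∈ shapes) → s∈ ≡ ∈-shapes s
∈-shapes-unique (here refl) = refl
∈-shapes-unique (there (here refl)) = refl
∈-shapes-unique (there (there (here refl))) = refl
∈-shapes-unique (there (there (there (here refl)))) = refl
∈-shapes-unique (there (there (there (there (here refl))))) = refl
∈-shapes-unique (there (there (there (there (there (here refl)))))) = refl
∈-shapes-unique (there (there (there (there (there (there (here refl))))))) = refl
∈-shapes-unique (there (there (there (there (there (there (there (here refl)))))))) = refl
∈-shapes-unique (there (there (there (there (there (there (there (there (here refl))))))))) = refl
∈-shapes-unique (there (there (there (there (there (there (there (there (there (here refl)))))))))) = refl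

all-shapes : {F : Shape → Set} → All F shapes → ∀ s → F s
all-shapes Fs s = All.lookup Fs (∈-shapes s)

preds : Shape → List Shape
preds Z  = Z ∷ []
preds A  = Z ∷ []
preds B  = A ∷ B ∷ []
preds C  = A ∷ C ∷ []
preds D  = C ∷ D ∷ []
preds R₂ = B ∷ []
preds P₂ = R₂ ∷ P₂ ∷ []
preds R  = A ∷ R ∷ R₂ ∷ []
preds P  = R ∷ P ∷ []
preds Q  = R ∷ P ∷ Q ∷ []

count : ℕ → Shape → ℕ
count zero    Z = 1
count zero    _ = 0
count (suc n) s = sum (map (count n) (preds s))

last-step↔ : ∀ {n} s → Path (suc n) s ↔ Any (Path n) (preds s)
last-step↔ Z = mk↔ₛ′
  (λ { (p ▷ Z-same) → here p })
  (λ { (here p) → p ▷ Z-same })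
  (λ { (here _) → refl })
  (λ { (_ ▷ Z-same) → refl })
last-step↔ A = mk↔ₛ′
  (λ { (p ▷ Z-up) → here p })
  (λ { (here p) → p ▷ Z-up })
  (λ { (here _) → refl })
  (λ { (_ ▷ Z-up) → refl })
last-step↔ B = mk↔ₛ′
  (λ { (p ▷ A-down) → here p ; (p ▷ B-same) → there (here p) })
  (λ { (here p) → p ▷ A-down ; (there (here p)) → p ▷ B-same })
  (λ { (here _) → refl ; (there (here _)) → refl })
  (λ { (_ ▷ A-down) → refl ; (_ ▷ B-same) → refl })
last-step↔ C = mk↔ₛ′
  (λ { (p ▷ A-same) → here p ; (p ▷ C-same) → there (here p) })
  (λ { (here p) → p ▷ A-same ; (there (here p)) → p ▷ C-same })
  (λ { (here _) → refl ; (there (here _)) → refl })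
  (λ { (_ ▷ A-same) → refl ; (_ ▷ C-same) → refl })
last-step↔ D = mk↔ₛ′
  (λ { (p ▷ C-down) → here p ; (p ▷ D-same) → there (here p) })
  (λ { (here p) → p ▷ C-down ; (there (here p)) → p ▷ D-same })
  (λ { (here _) → refl ; (there (here _)) → refl })
  (λ { (_ ▷ C-down) → refl ; (_ ▷ D-same) → refl })
last-step↔ R₂ = mk↔ₛ′
  (λ { (p ▷ B-up) → here p })
  (λ { (here p) → p ▷ B-up })
  (λ { (here _) → refl })
  (λ { (_ ▷ B-up) → refl })
last-step↔ P₂ = mk↔ₛ′
  (λ { (p ▷ R₂-same) → here p ; (p ▷ P₂-same) → there (here p) })
  (λ { (here p) → p ▷ R₂-same ; (there (here p)) → p ▷ P₂-same })
  (λ { (here _) → refl ; (there (here _)) → refl })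
  (λ { (_ ▷ R₂-same) → refl ; (_ ▷ P₂-same) → refl })
last-step↔ R = mk↔ₛ′
  (λ { (p ▷ A-up) → here p ; (p ▷ R-up) → there (here p) ; (p ▷ R₂-up) → there (there (here p)) })
  (λ { (here p) → p ▷ A-up ; (there (here p)) → p ▷ R-up ; (there (there (here p))) → p ▷ R₂-up })
  (λ { (here _) → refl ; (there (here _)) → refl ; (there (there (here _))) → refl })
  (λ { (_ ▷ A-up) → refl ; (_ ▷ R-up) → refl ; (_ ▷ R₂-up) → refl })
last-step↔ P = mk↔ₛ′
  (λ { (p ▷ R-same) → here p ; (p ▷ P-same) → there (here p) })
  (λ { (here p) → p ▷ R-same ; (there (here p)) → p ▷ P-same })
  (λ { (here _) → refl ; (there (here _)) → refl })
  (λ { (_ ▷ R-same) → refl ; (_ ▷ P-same) → refl })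
last-step↔ Q = mk↔ₛ′
  (λ { (p ▷ R-down) → here p ; (p ▷ P-down) → there (here p) ; (p ▷ Q-same) → there (there (here p)) })
  (λ { (here p) → p ▷ R-down ; (there (here p)) → p ▷ P-down ; (there (there (here p))) → p ▷ Q-same })
  (λ { (here _) → refl ; (there (here _)) → refl ; (there (there (here _))) → refl })
  (λ { (_ ▷ R-down) → refl ; (_ ▷ P-down) → refl ; (_ ▷ Q-same) → refl })

paths↔Fin : ∀ n s → Path n s ↔ Fin (count n s)
paths↔Fin zero Z  = mk↔ₛ′ (λ _ → zero) (λ _ → start) (λ { zero → refl }) (λ { start → refl })
paths↔Fin zero A  = mk↔ₛ′ (λ ()) (λ ()) (λ ()) (λ ())
paths↔Fin zero B  = mk↔ₛ′ (λ ()) (λ ()) (λ ()) (λ ())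
paths↔Fin zero C  = mk↔ₛ′ (λ ()) (λ ()) (λ ()) (λ ())
paths↔Fin zero D  = mk↔ₛ′ (λ ()) (λ ()) (λ ()) (λ ())
paths↔Fin zero R₂ = mk↔ₛ′ (λ ()) (λ ()) (λ ()) (λ ())
paths↔Fin zero P₂ = mk↔ₛ′ (λ ()) (λ ()) (λ ()) (λ ())
paths↔Fin zero R  = mk↔ₛ′ (λ ()) (λ ()) (λ ()) (λ ())
paths↔Fin zero P  = mk↔ₛ′ (λ ()) (λ ()) (λ ()) (λ ())
paths↔Fin zero Q  = mk↔ₛ′ (λ ()) (λ ()) (λ ()) (λ ())
paths↔Fin (suc n) s = ↔-trans (last-step↔ s) (Any↔Fin (paths↔Fin n) (preds s))

total : ℕ → ℕ
total n = sum (map (count n) shapes)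

paths↔total : ∀ n → Σ Shape (Path n) ↔ Fin (total n)
paths↔total n = ↔-trans (Σ↔Any ∈-shapes ∈-shapes-unique) (Any↔Fin (paths↔Fin n) shapes)

-- Closed forms

-- Integer polynomials as coefficient lists, constant term first.
⟦_⟧ : List ℤ → ℤ → ℤ
⟦ [] ⟧    x = 0ℤ
⟦ c ∷ p ⟧ x = c + x * ⟦ p ⟧ x

_⊕_ : List ℤ → List ℤ → List ℤ
[]      ⊕ q       = q
(c ∷ p) ⊕ []      = c ∷ p
(c ∷ p) ⊕ (d ∷ q) = c + d ∷ p ⊕ q

⨁ : List (List ℤ) → List ℤ
⨁ = foldr _⊕_ []

shift : List ℤ → List ℤ
shift []      = []
shift (c ∷ p) = (c ∷ []) ⊕ ((0ℤ ∷ shift p) ⊕ shift p)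

⟦⊕⟧ : ∀ p q x → ⟦ p ⊕ q ⟧ x ≡ ⟦ p ⟧ x + ⟦ q ⟧ x
⟦⊕⟧ []      q       x = sym (ℤ.+-identityˡ _)
⟦⊕⟧ (c ∷ p) []      x = sym (ℤ.+-identityʳ _)
⟦⊕⟧ (c ∷ p) (d ∷ q) x = trans (cong (λ r → c + d + x * r) (⟦⊕⟧ p q x)) (lemma c d x (⟦ p ⟧ x) (⟦ q ⟧ x))
  where
  lemma : ∀ c d x u v → c + d + x * (u + v) ≡ c + x * u + (d + x * v)
  lemma = solve-∀

⟦shift⟧ : ∀ p x → ⟦ shift p ⟧ x ≡ ⟦ p ⟧ (1ℤ + x)
⟦shift⟧ []      x = refl
⟦shift⟧ (c ∷ p) x = begin
  ⟦ (c ∷ []) ⊕ ((0ℤ ∷ shift p) ⊕ shift p) ⟧ x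
    ≡⟨ ⟦⊕⟧ (c ∷ []) ((0ℤ ∷ shift p) ⊕ shift p) x ⟩
  ⟦ c ∷ [] ⟧ x + ⟦ (0ℤ ∷ shift p) ⊕ shift p ⟧ x
    ≡⟨ cong (λ r → ⟦ c ∷ [] ⟧ x + r) (⟦⊕⟧ (0ℤ ∷ shift p) (shift p) x) ⟩
  c + x * 0ℤ + (0ℤ + x * ⟦ shift p ⟧ x + ⟦ shift p ⟧ x)
    ≡⟨ cong (λ r → c + x * 0ℤ + (0ℤ + x * r + r)) (⟦shift⟧ p x) ⟩
  c + x * 0ℤ + (0ℤ + x * y + y)
    ≡⟨ lemma c x y ⟩
  c + (1ℤ + x) * y
    ∎
  where
  open ≡-Reasoning
  y = ⟦ p ⟧ (1ℤ + x)
  lemma : ∀ c x y → c + x * 0ℤ + (0ℤ + x * y + y) ≡ c + (1ℤ + x) * y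
  lemma = solve-∀

scaled-sum : ∀ {I : Set} c {f : I → ℕ} {g : I → List ℤ} {x} → (∀ i → + (c ℕ.* f i) ≡ ⟦ g i ⟧ x) →
             ∀ is → + (c ℕ.* sum (map f is)) ≡ ⟦ ⨁ (map g is) ⟧ x
scaled-sum c hyp [] = cong +_ (*-zeroʳ c)
scaled-sum c {f} {g} {x} hyp (i ∷ is) = begin
  + (c ℕ.* (f i ℕ.+ sum (map f is)))        ≡⟨ cong +_ (*-distribˡ-+ c (f i) _) ⟩
  + (c ℕ.* f i ℕ.+ c ℕ.* sum (map f is))    ≡⟨ pos-+ (c ℕ.* f i) _ ⟩
  + (c ℕ.* f i) + + (c ℕ.* sum (map f is))  ≡⟨ cong₂ _+_ (hyp i) (scaled-sum c hyp is) ⟩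
  ⟦ g i ⟧ x + ⟦ ⨁ (map g is) ⟧ x            ≡⟨ ⟦⊕⟧ (g i) _ x ⟨
  ⟦ g i ⊕ ⨁ (map g is) ⟧ x                  ∎
  where open ≡-Reasoning

-- Closed forms of 24 · count (2 + m) s in m; the factor 24 clears denominators.
closedForm : Shape → List ℤ
closedForm Z  = + 24 ∷ []
closedForm A  = + 24 ∷ []
closedForm B  = + 24 ∷ + 24 ∷ []
closedForm C  = + 24 ∷ + 24 ∷ []
closedForm D  = 0ℤ ∷ + 12 ∷ + 12 ∷ []
closedForm R₂ = 0ℤ ∷ + 24 ∷ []
closedForm P₂ = 0ℤ ∷ - + 12 ∷ + 12 ∷ []
closedForm R  = + 24 ∷ + 12 ∷ + 12 ∷ []
closedForm P  = 0ℤ ∷ + 20 ∷ 0ℤ ∷ + 4 ∷ []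
closedForm Q  = 0ℤ ∷ + 10 ∷ + 11 ∷ + 2 ∷ + 1 ∷ []

closedForm-shift : ∀ s → shift (closedForm s) ≡ ⨁ (map closedForm (preds s))
closedForm-shift = all-shapes (refl ∷ refl ∷ refl ∷ refl ∷ refl ∷ refl ∷ refl ∷ refl ∷ refl ∷ refl ∷ [])

count-closedForm : ∀ m s → + (24 ℕ.* count (2 ℕ.+ m) s) ≡ ⟦ closedForm s ⟧ (+ m)
count-closedForm zero = all-shapes (refl ∷ refl ∷ refl ∷ refl ∷ refl ∷ refl ∷ refl ∷ refl ∷ refl ∷ refl ∷ [])
count-closedForm (suc m) s = begin
  + (24 ℕ.* count (3 ℕ.+ m) s)
    ≡⟨ scaled-sum 24 {f = count (2 ℕ.+ m)} {g = closedForm} (count-closedForm m) (preds s) ⟩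
  ⟦ ⨁ (map closedForm (preds s)) ⟧ (+ m)
    ≡⟨ cong (λ p → ⟦ p ⟧ (+ m)) (closedForm-shift s) ⟨
  ⟦ shift (closedForm s) ⟧ (+ m)
    ≡⟨ ⟦shift⟧ (closedForm s) (+ m) ⟩
  ⟦ closedForm s ⟧ (+ suc m)
    ∎
  where open ≡-Reasoning

quartic : List ℤ
quartic = + 120 ∷ - + 114 ∷ + 47 ∷ - + 6 ∷ + 1 ∷ []

⨁-closedForm : ⨁ (map closedForm shapes) ≡ shift (shift (shift quartic))
⨁-closedForm = refl

⟦quartic⟧ : ∀ x → ⟦ quartic ⟧ x ≡ x ^ 4 - + 6 * x ^ 3 + + 47 * x ^ 2 - + 114 * x + + 120
⟦quartic⟧ = horner
  where
  -- The ring solver does not handle _^_, so the powers (which x ^ n unfolds to) are spelt out.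
  horner : ∀ x → + 120 + x * (- + 114 + x * (+ 47 + x * (- + 6 + x * (+ 1 + x * 0ℤ))))
               ≡ x * (x * (x * (x * 1ℤ))) - + 6 * (x * (x * (x * 1ℤ))) + + 47 * (x * (x * 1ℤ))
                 - + 114 * x + + 120
  horner = solve-∀

total-quartic : ∀ m → + 24 * + total (2 ℕ.+ m) ≡ ⟦ quartic ⟧ (+ (3 ℕ.+ m))
total-quartic m = begin
  + 24 * + total (2 ℕ.+ m)
    ≡⟨ pos-* 24 (total (2 ℕ.+ m)) ⟨
  + (24 ℕ.* total (2 ℕ.+ m))
    ≡⟨ scaled-sum 24 {f = count (2 ℕ.+ m)} {g = closedForm} (count-closedForm m) shapes ⟩
  ⟦ ⨁ (map closedForm shapes) ⟧ (+ m)
    ≡⟨ cong (λ p → ⟦ p ⟧ (+ m)) ⨁-closedForm ⟩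
  ⟦ shift (shift (shift quartic)) ⟧ (+ m)
    ≡⟨ ⟦shift⟧ (shift (shift quartic)) (+ m) ⟩
  ⟦ shift (shift quartic) ⟧ (+ (1 ℕ.+ m))
    ≡⟨ ⟦shift⟧ (shift quartic) (+ (1 ℕ.+ m)) ⟩
  ⟦ shift quartic ⟧ (+ (2 ℕ.+ m))
    ≡⟨ ⟦shift⟧ quartic (+ (2 ℕ.+ m)) ⟩
  ⟦ quartic ⟧ (+ (3 ℕ.+ m))
    ∎
  where open ≡-Reasoning

𝒜↔total : ∀ n → 𝒜 P₃ (suc n) ↔ Fin (total n)
𝒜↔total n = ↔-trans (𝒜↔paths n) (paths↔total n)

theorem4p1 : (𝒜 P₃ 1 ↔ Fin 1)
  × ((n : ℕ) → 2 ≤ n → Σ ℕ (λ m → (𝒜 P₃ n ↔ Fin m)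
      × (+ 24 * + m ≡ (+ n) ^ 4 - + 6 * (+ n) ^ 3 + + 47 * (+ n) ^ 2 - + 114 * + n + + 120)))
theorem4p1 = 𝒜↔total 0 , λ where
  (suc zero) (s≤s ())
  (suc (suc zero)) _ → total 1 , 𝒜↔total 1 , refl
  (suc (suc (suc m))) _ →
    total (2 ℕ.+ m) , 𝒜↔total (2 ℕ.+ m) , trans (total-quartic m) (⟦quartic⟧ (+ (3 ℕ.+ m)))
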